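{- Let $G$ be a finite graph (without loops or multiple edges) with no isolated vertices, having $|G|$ vertices. If $|G|=2N+1$ and $G$ is almost Hamiltonian, then there exists no nontrivial circuit injection $f: G_M\to B$ with $B$ a binary matroid. If $|G|=2N$ and $G$ is Hamiltonian, then there exists no nontrivial circuit injection $f: G_M\to B$ with $B$ a binary matroid.
   Context: $G_M$ denotes the cycle matroid of $G$: its cells are the edges of $G$ and its circuits are the circuits (cycles, as edge sets) of $G$. A matroid $\{S,\mathscr{C}\}$ is given by its cell set and circuit family. It is binary if for all $A,B\in\mathscr{C}$, $A\oplus B=(A\cup B)\setminus(A\cap B)$ is a union of pairwise disjoint circuits. A circuit injection $f:\{S,\mathscr{C}\}\to\{S',\mathscr{C}'\}$ is a bijection $S\to S'$ mapping every member of $\mathscr{C}$ to a member of $\mathscr{C}'$; it is nontrivial if some member of $\mathscr{C}'$ is not the image of a member of $\mathscr{C}$. $G$ is Hamiltonian if it has a circuit through all vertices. A graph of order $n$ is almost Hamiltonian if every set of $n-1$ of its vertices is contained in (the vertex set of) some circuit. -}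

module Defs where

open import Data.Nat using (ℕ; suc; _≤_; _+_; _*_)
open import Data.Fin using (Fin; zero; suc; inject₁; fromℕ)
open import Data.Fin.Subset using (Subset; _∈_; _⊆_; _∪_; _∩_; _─_; _-_; ⋃; ⊥; Empty)
open import Data.Vec using (lookup; tabulate)
open import Data.List using (List)
open import Data.List.Relation.Unary.All using (All)
open import Data.List.Relation.Unary.AllPairs using (AllPairs)
open import Data.Product using (Σ; ∃; _×_; _,_; proj₁; proj₂)
open import Data.Sum using (_⊎_)
open import Function.Bundles using (_↔_; Inverse)
open import Function.Definitions using (Injective)
open import Relation.Binary.PropositionalEquality using (_≡_; _≢_)
open import Relation.Nullary using (¬_)
open import Function.Bundles using (_⇔_)

record Graph : Set where
  field
    n     : ℕ
    m     : ℕ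
    ends  : Fin m → Fin n × Fin n

  Joins : Fin m → Fin n → Fin n → Set
  Joins e u v = (ends e ≡ (u , v)) ⊎ (ends e ≡ (v , u))

  field
    noLoop  : ∀ e → proj₁ (ends e) ≢ proj₂ (ends e)
    noMulti : ∀ e e′ → Joins e (proj₁ (ends e′)) (proj₂ (ends e′)) → e ≡ e′

  Adj : Fin n → Fin n → Set
  Adj u v = ∃ λ e → Joins e u v

  Incident : Fin n → Fin m → Set
  Incident v e = (proj₁ (ends e) ≡ v) ⊎ (proj₂ (ends e) ≡ v)

  NoIsolatedVertices : Set
  NoIsolatedVertices = ∀ v → ∃ λ e → Incident v e

  record Cycle : Set where
    field
      len    : ℕ                      -- number of vertices is suc len
      long   : 2 ≤ len
      vert   : Fin (suc len) → Fin n
      inj    : Injective _≡_ _≡_ vert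
      step   : ∀ (i : Fin len) → Adj (vert (inject₁ i)) (vert (suc i))
      close  : Adj (vert (fromℕ len)) (vert zero)

    CycleEdge : Fin m → Set
    CycleEdge e = (∃ λ (i : Fin len) → Joins e (vert (inject₁ i)) (vert (suc i)))
                ⊎ Joins e (vert (fromℕ len)) (vert zero)

    OnCycle : Fin n → Set
    OnCycle w = ∃ λ i → vert i ≡ w

  IsCircuit : Subset m → Set
  IsCircuit S = Σ Cycle λ c → ∀ e → (e ∈ S) ⇔ Cycle.CycleEdge c e

  Hamiltonian : Set
  Hamiltonian = Σ Cycle λ c → ∀ w → Cycle.OnCycle c w

  -- every set of n-1 vertices (= all vertices but one, v) lies on a circuit
  AlmostHamiltonian : Set
  AlmostHamiltonian = ∀ v → Σ Cycle λ c → ∀ w → w ≢ v → Cycle.OnCycle c w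

Disjoint : ∀ {k} → Subset k → Subset k → Set
Disjoint A B = Empty (A ∩ B)

_⊕_ : ∀ {k} → Subset k → Subset k → Subset k
A ⊕ B = (A ∪ B) ─ (A ∩ B)

record Matroid (k : ℕ) : Set₁ where
  field
    IsCircuit   : Subset k → Set
    emptyNot    : ¬ IsCircuit ⊥
    minimal     : ∀ {C₁ C₂} → IsCircuit C₁ → IsCircuit C₂ → C₁ ⊆ C₂ → C₁ ≡ C₂
    elimination : ∀ {C₁ C₂ e} → IsCircuit C₁ → IsCircuit C₂ → C₁ ≢ C₂ →
                  e ∈ C₁ → e ∈ C₂ →
                  ∃ λ C₃ → IsCircuit C₃ × C₃ ⊆ ((C₁ ∪ C₂) - e)

IsBinary : ∀ {k} → Matroid k → Set
IsBinary {k} B = ∀ {A C} → IsCircuit A → IsCircuit C →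
  ∃ λ (Cs : List (Subset k)) →
    All IsCircuit Cs × AllPairs Disjoint Cs × (⋃ Cs ≡ (A ⊕ C))
  where open Matroid B

image : ∀ {m k} → Fin m ↔ Fin k → Subset m → Subset k
image f S = tabulate λ j → lookup S (Inverse.from f j)

IsCircuitInjection : (G : Graph) → ∀ {k} → Matroid k → Fin (Graph.m G) ↔ Fin k → Set
IsCircuitInjection G B f =
  ∀ S → Graph.IsCircuit G S → Matroid.IsCircuit B (image f S)

Nontrivial : (G : Graph) → ∀ {k} → Matroid k → Fin (Graph.m G) ↔ Fin k → Set
Nontrivial G B f =
  ∃ λ C′ → Matroid.IsCircuit B C′ ×
    ¬ (∃ λ S → Graph.IsCircuit G S × image f S ≡ C′)

ExistsNontrivialBinaryCI : Graph → Set₁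
ExistsNontrivialBinaryCI G =
  ∃ λ k → Σ (Matroid k) λ B → IsBinary B × Σ (Fin (Graph.m G) ↔ Fin k) λ f →
    IsCircuitInjection G B f × Nontrivial G B f

-- Let f : G_M → B be a circuit injection into a binary matroid B and let X be
-- the edge set corresponding to a circuit of B.  We show that X is a circuit of G.
--  1. In a binary matroid, unions of disjoint circuits are closed under
--     symmetric difference (CircuitSums.Closure); since cycles of G are
--     circuits of B, adding the edges of a cycle preserves such unions.
--  2. Let H be a cycle through all vertices except possibly w, with w ∈ H or w
--     of even degree in X.  Adding chord cycles of H and detours through w
--     carries X into H without changing degree parities (AlongCycle.Reduction).
--     A union of disjoint circuits inside H is ∅ or H, so X has even degrees.
--  3. An edge set with even degrees contains a cycle (CycleInEvenSet); by
--     minimality of circuits X is that cycle.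
-- For odd order the handshake lemma provides w and almost-Hamiltonicity the
-- cycle H; for even order a Hamiltonian cycle serves.  Edge sets are
-- characteristic functions, degree parities are sums over 𝔽₂ = (Bool, xor, ∧).

module Submission where

open import Defs
open import Algebra.Bundles using (CommutativeRing)
open import Data.Bool using (Bool; true; false; _∧_; _∨_; _xor_; not; if_then_else_)
open import Data.Bool.Properties as BP using (xor-∧-commutativeRing)
open import Data.Nat using (ℕ; zero; suc; _+_; _*_; _≤_; _<_; z≤n; s≤s)
open import Data.Nat.Properties as NP using ()
open import Data.Fin using (Fin; zero; suc; toℕ; inject₁; fromℕ; fromℕ<)
open import Data.Fin.Properties as FP using ()
open import Data.Fin.Subset as SS using (Subset; _─_; _∪_; _∩_; ⋃)
open import Data.Vec using (Vec; []; _∷_; lookup; tabulate)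
open import Data.Vec.Properties as VP using ()
open import Function.Bundles using (_↔_; Inverse; mk⇔)
open import Data.List using ([]; _∷_)
open import Data.List.Relation.Unary.All using (All; []; _∷_)
open import Data.List.Relation.Unary.AllPairs using (AllPairs; []; _∷_)
open import Data.Product using (Σ; ∃; _×_; _,_; proj₁; proj₂)
open import Data.Sum using (_⊎_; inj₁; inj₂; map₂)
open import Relation.Binary.PropositionalEquality
open import Relation.Nullary using (¬_; Dec; yes; no; does; contradiction)
open import Relation.Nullary.Decidable using (_×-dec_)
open import Relation.Binary using (tri<; tri≈; tri>)
open import Function using (_∘_)
open import Data.Nat.Tactic.RingSolver using (solve-∀)

module 𝔽₂ = CommutativeRing xor-∧-commutativeRing
open import Algebra.Properties.Semiring.Sum 𝔽₂.semiring
  using (sum-cong-≗; sum-replicate-zero; sum-init-last; ∑-distrib-+; ∑-comm; *-distribˡ-sum; *-distribʳ-sum)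
  renaming (sum to ⨁)
open import Algebra.Properties.CommutativeSemigroup 𝔽₂.+-commutativeSemigroup
  using (interchange)

true≢false : true ≢ false
true≢false ()

Cells : ℕ → Set
Cells k = Fin k → Bool

∅ᶜ : ∀ {k} → Cells k
∅ᶜ _ = false

_△_ _∪ᶜ_ _∩ᶜ_ : ∀ {k} → Cells k → Cells k → Cells k
(s △ t) i = s i xor t i
(s ∪ᶜ t) i = s i ∨ t i
(s ∩ᶜ t) i = s i ∧ t i

_⊆ᶜ_ : ∀ {k} → Cells k → Cells k → Set
s ⊆ᶜ t = ∀ i → s i ≡ true → t i ≡ true

Disjointᶜ : ∀ {k} → Cells k → Cells k → Set
Disjointᶜ s t = ∀ i → s i ∧ t i ≡ false

∨≡xor : ∀ a b → a ∧ b ≡ false → a ∨ b ≡ a xor b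
∨≡xor false b _ = refl
∨≡xor true false _ = refl

∧≡true : ∀ {a b} → a ∧ b ≡ true → (a ≡ true) × (b ≡ true)
∧≡true {true} {true} _ = refl , refl

not≡true : ∀ {a} → not a ≡ true → a ≡ false
not≡true {false} _ = refl

empty-or-member : ∀ {k} (s : Cells k) → (∀ i → s i ≡ false) ⊎ (∃ λ i → s i ≡ true)
empty-or-member s with FP.any? (λ i → s i BP.≟ true)
... | yes member = inj₂ member
... | no none = inj₁ (λ i → BP.¬-not (λ si → none (i , si)))

⨁-zero : ∀ {k} (f : Cells k) → (∀ i → f i ≡ false) → ⨁ f ≡ false
⨁-zero {k} f f≡0 = trans (sum-cong-≗ f≡0) (sum-replicate-zero k)

⨁-single : ∀ {k} (f : Cells k) x → (∀ i → i ≢ x → f i ≡ false) → ⨁ f ≡ f x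
⨁-single {suc k} f zero off =
  trans (cong (f zero xor_) (⨁-zero _ (λ i → off (suc i) (λ ())))) (BP.xor-identityʳ _)
⨁-single {suc k} f (suc x) off =
  trans (cong (_xor ⨁ (λ i → f (suc i))) (off zero (λ ())))
        (⨁-single (λ i → f (suc i)) x (λ i i≢x → off (suc i) (i≢x ∘ FP.suc-injective)))

⨁-true : ∀ {k} (f : Cells k) → ⨁ f ≡ true → ∃ λ i → f i ≡ true
⨁-true f ⨁f≡1 with empty-or-member f
... | inj₁ f≡0 = contradiction (trans (sym ⨁f≡1) (⨁-zero f f≡0)) true≢false
... | inj₂ member = member

⨁-odd : ∀ N → ⨁ {suc (2 * N)} (λ _ → true) ≡ true
⨁-odd zero = refl
⨁-odd (suc N) rewrite NP.+-suc N (N + 0) = trans (BP.not-involutive _) (⨁-odd N)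

-- The number of elements of a cell set; it is the termination measure of
-- the two inductions below.

bit : Bool → ℕ
bit b = if b then 1 else 0

size : ∀ {k} → Cells k → ℕ
size {zero} s = 0
size {suc k} s = bit (s zero) + size (s ∘ suc)

size-cong : ∀ {k} {s t : Cells k} → s ≗ t → size s ≡ size t
size-cong {zero} s≗t = refl
size-cong {suc k} s≗t = cong₂ _+_ (cong bit (s≗t zero)) (size-cong (s≗t ∘ suc))

size-∅ : ∀ {k} {s : Cells k} → (∀ i → s i ≡ false) → size s ≡ 0
size-∅ {zero} _ = refl
size-∅ {suc k} {s} s≡0 rewrite s≡0 zero = size-∅ (s≡0 ∘ suc)

size-△ : ∀ {k} (s t : Cells k) → size (s △ t) + 2 * size (s ∩ᶜ t) ≡ size s + size t
size-△ {zero} s t = refl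
size-△ {suc k} s t = step (s zero) (t zero) (size-△ (s ∘ suc) (t ∘ suc))
  where
  pull-2ˡ : ∀ x y → x + 2 * (1 + y) ≡ 2 + (x + 2 * y)
  pull-2ˡ = solve-∀
  pull-2ʳ : ∀ z w → 2 + (z + w) ≡ (1 + z) + (1 + w)
  pull-2ʳ = solve-∀
  step : ∀ a b {x y z w} → x + 2 * y ≡ z + w →
         (bit (a xor b) + x) + 2 * (bit (a ∧ b) + y) ≡ (bit a + z) + (bit b + w)
  step false false eq = eq
  step false true {z = z} {w} eq = trans (cong suc eq) (sym (NP.+-suc z w))
  step true false eq = cong suc eq
  step true true {x} {y} {z} {w} eq =
    trans (pull-2ˡ x y) (trans (cong (2 +_) eq) (pull-2ʳ z w))

bit-mono : ∀ {a b} → (a ≡ true → b ≡ true) → bit a ≤ bit b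
bit-mono {false} _ = z≤n
bit-mono {true} a⇒b rewrite a⇒b refl = NP.≤-refl

size-mono : ∀ {k} {s t : Cells k} → s ⊆ᶜ t → size s ≤ size t
size-mono {zero} _ = z≤n
size-mono {suc k} s⊆t = NP.+-mono-≤ (bit-mono (s⊆t zero)) (size-mono (s⊆t ∘ suc))

size-mono-< : ∀ {k} {s t : Cells k} → s ⊆ᶜ t → ∀ e → t e ≡ true → s e ≡ false → size s < size t
size-mono-< {suc k} s⊆t zero te se rewrite te | se = s≤s (size-mono (s⊆t ∘ suc))
size-mono-< {suc k} s⊆t (suc e) te se =
  NP.+-mono-≤-< (bit-mono (s⊆t zero)) (size-mono-< (s⊆t ∘ suc) e te se)

size-pos : ∀ {k} (s : Cells k) e → s e ≡ true → 0 < size s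
size-pos {k} s e se = subst (_< size s) (size-∅ {k} {∅ᶜ} (λ _ → refl)) (size-mono-< {s = ∅ᶜ} (λ _ ()) e se refl)

size-∪-disjoint : ∀ {k} (s t : Cells k) → Disjointᶜ s t → size (s ∪ᶜ t) ≡ size s + size t
size-∪-disjoint s t s∩t≡∅ = begin
  size (s ∪ᶜ t)                          ≡⟨ size-cong (λ i → ∨≡xor (s i) (t i) (s∩t≡∅ i)) ⟩
  size (s △ t)                           ≡⟨ NP.+-identityʳ _ ⟨
  size (s △ t) + 2 * 0                   ≡⟨ cong (λ z → size (s △ t) + 2 * z) (size-∅ s∩t≡∅) ⟨
  size (s △ t) + 2 * size (s ∩ᶜ t)       ≡⟨ size-△ s t ⟩
  size s + size t                        ∎
  where
  open ≡-Reasoning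

size-△-≤ : ∀ {k} (s t : Cells k) → size (s △ t) ≤ size s + size t
size-△-≤ s t = subst (size (s △ t) ≤_) (size-△ s t) (NP.m≤m+n _ _)

size-△-< : ∀ {k} (s t : Cells k) e → s e ∧ t e ≡ true → size (s △ t) < size s + size t
size-△-< s t e st = subst (size (s △ t) <_) (size-△ s t)
  (NP.m<m+n _ (NP.≤-trans (size-pos (s ∩ᶜ t) e st) (NP.m≤m+n _ _)))

module CircuitSums {k : ℕ} (Circuit : Cells k → Set) where

  data CircuitSum (s : Cells k) : Set where
    noCircuit  : (∀ i → s i ≡ false) → CircuitSum s
    addCircuit : ∀ C s′ → Circuit C → CircuitSum s′ → Disjointᶜ C s′ → s ≗ C ∪ᶜ s′ →
                 CircuitSum s

  CircuitSum-resp : ∀ {s t} → s ≗ t → CircuitSum s → CircuitSum t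
  CircuitSum-resp s≗t (noCircuit s≡∅) = noCircuit (λ i → trans (sym (s≗t i)) (s≡∅ i))
  CircuitSum-resp s≗t (addCircuit C s′ c z d s≡) = addCircuit C s′ c z d (λ i → trans (sym (s≗t i)) (s≡ i))

  singleton : ∀ {C} → Circuit C → CircuitSum C
  singleton {C} c =
    addCircuit C ∅ᶜ c (noCircuit (λ _ → refl)) (λ i → BP.∧-zeroʳ (C i)) (λ i → sym (BP.∨-identityʳ (C i)))

  record Split (t : Cells k) : Set where
    constructor split
    field
      D t′       : Cells k
      circuit    : Circuit D
      rest       : CircuitSum t′
      disjoint   : Disjointᶜ D t′
      decomposes : t ≗ D ∪ᶜ t′

  -- Every element i of a circuit sum lies in a summand: the decomposition
  -- can be reordered so that the first circuit contains i.
  splitAt : ∀ {t} → CircuitSum t → ∀ i → t i ≡ true → Σ (Split t) λ sp → Split.D sp i ≡ true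
  splitAt (noCircuit t≡∅) i ti = contradiction (trans (sym ti) (t≡∅ i)) true≢false
  splitAt (addCircuit C t₀ cC sum₀ C∩t₀ t≡) i ti with C i in Ci
  ... | true = split C t₀ cC sum₀ C∩t₀ t≡ , Ci
  ... | false with splitAt sum₀ i (trans (sym (cong (_∨ t₀ i) Ci)) (trans (sym (t≡ i)) ti))
  ... | split D t₀′ cD sum₀′ D∩t₀′ t₀≡ , Di =
    split D (C ∪ᶜ t₀′) cD
      (addCircuit C t₀′ cC sum₀′ (λ j → shrink (C j) (t₀ j) (D j) (C∩t₀ j) (t₀≡ j)) (λ _ → refl))
      (λ j → moveOut (C j) (t₀ j) (D j) (C∩t₀ j) (t₀≡ j) (D∩t₀′ j))
      (λ j → trans (t≡ j) (reassoc (C j) (D j) (t₀≡ j)))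
    , Di
    where
    shrink : ∀ c t₀ d {t₀′} → c ∧ t₀ ≡ false → t₀ ≡ d ∨ t₀′ → c ∧ t₀′ ≡ false
    shrink false _ _ _ _ = refl
    shrink true false false refl refl = refl
    moveOut : ∀ c t₀ d {t₀′} → c ∧ t₀ ≡ false → t₀ ≡ d ∨ t₀′ → d ∧ t₀′ ≡ false →
              d ∧ (c ∨ t₀′) ≡ false
    moveOut c t₀ false _ _ _ = refl
    moveOut false t₀ true {false} _ _ _ = refl
    moveOut true false true _ () _
    moveOut true true true () _ _
    reassoc : ∀ c d {t₀ t₀′} → t₀ ≡ d ∨ t₀′ → c ∨ t₀ ≡ d ∨ (c ∨ t₀′)
    reassoc false _ refl = refl
    reassoc true false refl = refl
    reassoc true true refl = refl

  module Closure (nonempty : ∀ {C} → Circuit C → ∃ λ i → C i ≡ true)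
                 (binary : ∀ {A C} → Circuit A → Circuit C → CircuitSum (A △ C)) where

    rest-< : ∀ {s C s′ : Cells k} → s ≗ C ∪ᶜ s′ → Disjointᶜ C s′ → ∀ e → C e ≡ true → size s′ < size s
    rest-< {s} {C} {s′} s≡ C∩s′ e Ce =
      size-mono-< (λ i s′i → trans (s≡ i) (trans (cong (C i ∨_) s′i) (BP.∨-zeroʳ (C i))))
        e (trans (s≡ e) (cong (_∨ s′ e) Ce)) (trans (sym (cong (_∧ s′ e) Ce)) (C∩s′ e))

    overlap-< : ∀ {s C s′ t D t′ : Cells k} → s ≗ C ∪ᶜ s′ → Disjointᶜ C s′ → t ≗ D ∪ᶜ t′ → Disjointᶜ D t′ →
                ∀ i → C i ≡ true → D i ≡ true →
                size (s′ △ t′) + size (C △ D) < size s + size t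
    overlap-< {s} {C} {s′} {t} {D} {t′} s≡ C∩s′ t≡ D∩t′ i Ci Di = begin-strict
      size (s′ △ t′) + size (C △ D)     ≤⟨ NP.+-monoˡ-≤ _ (size-△-≤ s′ t′) ⟩
      (size s′ + size t′) + size (C △ D) <⟨ NP.+-monoʳ-< (size s′ + size t′) (size-△-< C D i (cong₂ _∧_ Ci Di)) ⟩
      (size s′ + size t′) + (size C + size D) ≡⟨ shuffle (size s′) (size t′) (size C) (size D) ⟩
      (size C + size s′) + (size D + size t′) ≡⟨ cong₂ _+_ (size-∪-disjoint C s′ C∩s′) (size-∪-disjoint D t′ D∩t′) ⟨
      size (C ∪ᶜ s′) + size (D ∪ᶜ t′)   ≡⟨ cong₂ _+_ (size-cong s≡) (size-cong t≡) ⟨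
      size s + size t                   ∎
      where
      open NP.≤-Reasoning
      shuffle : ∀ a b c d → (a + b) + (c + d) ≡ (c + a) + (d + b)
      shuffle = solve-∀

    -- Induction on |s| + |t|, peeling off the first circuit of s.
    △-closed-below : ∀ N {s t} → size s + size t < N → CircuitSum s → CircuitSum t → CircuitSum (s △ t)
    △-closed-below (suc N) _ (noCircuit s≡∅) sum-t =
      CircuitSum-resp (λ i → sym (cong (_xor _) (s≡∅ i))) sum-t
    △-closed-below (suc N) {s} {t} (s≤s bound) (addCircuit C s′ cC sum-s′ C∩s′ s≡) sum-t
      with empty-or-member (C ∩ᶜ t)
    ... | inj₁ C∩t≡∅ =
      -- C misses t, so s △ t = C ∪ (s′ △ t)
      let (e , Ce) = nonempty cC
          smaller = NP.<-≤-trans (NP.+-monoˡ-< (size t) (rest-< s≡ C∩s′ e Ce)) bound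
      in addCircuit C (s′ △ t) cC (△-closed-below N smaller sum-s′ sum-t)
           (λ i → missBoth (C i) (C∩s′ i) (C∩t≡∅ i))
           (λ i → peel (s i) (C i) (s≡ i) (C∩s′ i) (C∩t≡∅ i))
      where
      missBoth : ∀ c {s′ t} → c ∧ s′ ≡ false → c ∧ t ≡ false → c ∧ (s′ xor t) ≡ false
      missBoth false _ _ = refl
      missBoth true refl refl = refl
      peel : ∀ s c {s′ t} → s ≡ c ∨ s′ → c ∧ s′ ≡ false → c ∧ t ≡ false → s xor t ≡ c ∨ (s′ xor t)
      peel s false refl _ _ = refl
      peel s true refl refl refl = refl
    ... | inj₂ (i , Cti) with ∧≡true Cti
    ...   | Ci , ti with splitAt sum-t i ti
    ...     | split D t′ cD sum-t′ D∩t′ t≡ , Di =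
      -- s △ t = (s′ △ t′) △ (C △ D), and C △ D is a circuit sum because the matroid is binary
      CircuitSum-resp (λ j → sym (regroup (C j) (s′ j) (D j) (t′ j) (s≡ j) (C∩s′ j) (t≡ j) (D∩t′ j)))
        (△-closed-below N (NP.<-≤-trans (overlap-< {s} {C} {s′} {t} {D} {t′} s≡ C∩s′ t≡ D∩t′ i Ci Di) bound)
          (△-closed-below N (NP.<-≤-trans rests-< bound) sum-s′ sum-t′)
          (binary cC cD))
      where
      rests-< : size s′ + size t′ < size s + size t
      rests-< = NP.+-mono-< (rest-< s≡ C∩s′ i Ci) (rest-< t≡ D∩t′ i Di)
      regroup : ∀ c s′ d t′ {s t} → s ≡ c ∨ s′ → c ∧ s′ ≡ false → t ≡ d ∨ t′ → d ∧ t′ ≡ false →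
                s xor t ≡ (s′ xor t′) xor (c xor d)
      regroup c s′ d t′ refl c∩s′ refl d∩t′
        rewrite ∨≡xor c s′ c∩s′ | ∨≡xor d t′ d∩t′ =
        trans (interchange c s′ d t′) (BP.xor-comm (c xor d) (s′ xor t′))

    △-closed : ∀ {s t} → CircuitSum s → CircuitSum t → CircuitSum (s △ t)
    △-closed {s} {t} = △-closed-below (suc (size s + size t)) NP.≤-refl

-- The saturating map ℕ → Fin (suc L); it is exact on 0, …, L.
clamp : ℕ → (L : ℕ) → Fin (suc L)
clamp zero L = zero
clamp (suc k) zero = zero
clamp (suc k) (suc L) = suc (clamp k L)

toℕ-clamp : ∀ {k L} → k ≤ L → toℕ (clamp k L) ≡ k
toℕ-clamp {zero} _ = refl
toℕ-clamp {suc k} {suc L} (s≤s k≤L) = cong suc (toℕ-clamp k≤L)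

<⇒∃-+suc : ∀ {k k′} → k < k′ → ∃ λ d → k′ ≡ k + suc d
<⇒∃-+suc {k} k<k′ = let (d , k+1+d≡k′) = NP.m≤n⇒∃[o]m+o≡n k<k′ in d , trans (sym k+1+d≡k′) (sym (NP.+-suc k d))

_==_ : ∀ {k} → Fin k → Fin k → Bool
a == b = does (a FP.≟ b)

==-refl : ∀ {k} (a : Fin k) → (a == a) ≡ true
==-refl a with a FP.≟ a
... | yes _ = refl
... | no a≢a = contradiction refl a≢a

==-≡ : ∀ {k} {a b : Fin k} → a ≡ b → (a == b) ≡ true
==-≡ {a = a} refl = ==-refl a

==-≢ : ∀ {k} {a b : Fin k} → a ≢ b → (a == b) ≡ false
==-≢ {a = a} {b} a≢b with a FP.≟ b
... | yes a≡b = contradiction a≡b a≢b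
... | no _ = refl

==-true : ∀ {k} {a b : Fin k} → (a == b) ≡ true → a ≡ b
==-true {a = a} {b} eq with a FP.≟ b
... | yes a≡b = a≡b

==-distinct : ∀ {k} {x y : Fin k} v → x ≢ y → (x == v) ∨ (y == v) ≡ (x == v) xor (y == v)
==-distinct {x = x} {y} v x≢y with x FP.≟ v | y FP.≟ v
... | yes refl | yes refl = contradiction refl x≢y
... | yes _ | no _ = refl
... | no _ | _ = refl

⨁-point : ∀ {k} (x : Fin k) (g : Cells k) → ⨁ (λ e → (e == x) ∧ g e) ≡ g x
⨁-point x g = trans (⨁-single _ x (λ i i≢x → cong (_∧ g i) (==-≢ i≢x))) (cong (_∧ g x) (==-refl x))

-- Graphs: edges, incidence and degree parities.

module GraphFacts (G : Graph) where
  open Graph G public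

  joins-sym : ∀ {e a b} → Joins e a b → Joins e b a
  joins-sym (inj₁ p) = inj₂ p
  joins-sym (inj₂ p) = inj₁ p

  joins-≢ : ∀ {e a b} → Joins e a b → a ≢ b
  joins-≢ {e} (inj₁ p) a≡b = noLoop e (trans (cong proj₁ p) (trans a≡b (sym (cong proj₂ p))))
  joins-≢ {e} (inj₂ p) a≡b = noLoop e (trans (cong proj₁ p) (trans (sym a≡b) (sym (cong proj₂ p))))

  joins-ends : ∀ {e a b c d} → Joins e a b → Joins e c d → ((a ≡ c) × (b ≡ d)) ⊎ ((a ≡ d) × (b ≡ c))
  joins-ends (inj₁ refl) (inj₁ refl) = inj₁ (refl , refl)
  joins-ends (inj₁ refl) (inj₂ refl) = inj₂ (refl , refl)
  joins-ends (inj₂ refl) (inj₁ refl) = inj₂ (refl , refl)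
  joins-ends (inj₂ refl) (inj₂ refl) = inj₁ (refl , refl)

  joins-unique : ∀ {x y a b} → Joins x a b → Joins y a b → x ≡ y
  joins-unique {x} {y} jx (inj₁ p) = noMulti x y (subst (λ q → Joins x (proj₁ q) (proj₂ q)) (sym p) jx)
  joins-unique {x} {y} jx (inj₂ p) = noMulti x y (subst (λ q → Joins x (proj₁ q) (proj₂ q)) (sym p) (joins-sym jx))

  incident : Fin n → Fin m → Bool
  incident v e = (proj₁ (ends e) == v) ∨ (proj₂ (ends e) == v)

  -- The endpoints of an edge are distinct, so incidence is a sum of two point-indicators.
  incident-joins : ∀ {e a b} v → Joins e a b → incident v e ≡ (a == v) xor (b == v)
  incident-joins {e} {a} {b} v j = by-orientation j (joins-≢ j)
    where
    by-orientation : Joins e a b → a ≢ b → incident v e ≡ (a == v) xor (b == v)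
    by-orientation (inj₁ p) a≢b rewrite p = ==-distinct v a≢b
    by-orientation (inj₂ p) a≢b rewrite p =
      trans (==-distinct v (a≢b ∘ sym)) (BP.xor-comm (b == v) (a == v))

  incident-joins⁻ : ∀ {v e} → incident v e ≡ true → ∃ λ y → Joins e v y
  incident-joins⁻ {v} {e} inc with (proj₁ (ends e) == v) in first
  ... | true = proj₂ (ends e) , inj₁ (cong (_, proj₂ (ends e)) (==-true first))
  ... | false = proj₁ (ends e) , inj₂ (cong (proj₁ (ends e) ,_) (==-true inc))

  oddAt : Cells m → Fin n → Bool
  oddAt S v = ⨁ (λ e → S e ∧ incident v e)

  oddAt-cong : ∀ {S T} → S ≗ T → ∀ v → oddAt S v ≡ oddAt T v
  oddAt-cong S≗T v = sum-cong-≗ (λ e → cong (_∧ incident v e) (S≗T e))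

  oddAt-△ : ∀ S T v → oddAt (S △ T) v ≡ oddAt S v xor oddAt T v
  oddAt-△ S T v = trans (sum-cong-≗ (λ e → BP.∧-distribʳ-xor (incident v e) (S e) (T e)))
                        (∑-distrib-+ (λ e → S e ∧ incident v e) (λ e → T e ∧ incident v e))

  leave-again : ∀ {S e v b} → oddAt S v ≡ false → S e ≡ true → Joins e v b →
                ∃ λ e′ → ∃ λ y → e′ ≢ e × S e′ ≡ true × Joins e′ v y
  leave-again {S} {e} {v} {b} even Se j
    with empty-or-member (λ x → not (x == e) ∧ (S x ∧ incident v x))
  ... | inj₂ (e′ , other) =
    let (e′-new , Se′∧inc) = ∧≡true {not (e′ == e)} other
        (Se′ , inc) = ∧≡true {S e′} Se′∧inc
    in e′ , proj₁ (incident-joins⁻ inc) , (λ e′≡e → true≢false (trans (sym e′-new) (cong not (==-≡ e′≡e)))) ,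
       Se′ , proj₂ (incident-joins⁻ inc)
  ... | inj₁ no-other = contradiction (trans (sym at-e) (trans (sym only-e) even)) true≢false
    where
    only-e : oddAt S v ≡ S e ∧ incident v e
    only-e = ⨁-single _ e (λ x x≢e → subst (λ z → not z ∧ _ ≡ false) (==-≢ x≢e) (no-other x))
    at-e : S e ∧ incident v e ≡ true
    at-e = cong₂ _∧_ Se (trans (incident-joins v j)
             (cong₂ _xor_ (==-refl v) (==-≢ (joins-≢ j ∘ sym))))

  -- Handshake lemma mod 2: every edge has two endpoints, so the number of
  -- odd-degree vertices of any edge set is even.
  handshake : ∀ S → ⨁ (oddAt S) ≡ false
  handshake S = trans (∑-comm (λ v e → S e ∧ incident v e))
    (⨁-zero _ (λ e → trans (sym (*-distribˡ-sum (S e) (λ v → incident v e)))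
                           (trans (cong (S e ∧_) (edge-parity e)) (BP.∧-zeroʳ (S e)))))
    where
    indicator : ∀ x → ⨁ (λ v → x == v) ≡ true
    indicator x = trans (⨁-single _ x (λ v v≢x → ==-≢ (v≢x ∘ sym))) (==-refl x)
    edge-parity : ∀ e → ⨁ (λ v → incident v e) ≡ false
    edge-parity e = trans (sum-cong-≗ (λ v → incident-joins v (inj₁ refl)))
      (trans (∑-distrib-+ (proj₁ (ends e) ==_) (proj₂ (ends e) ==_))
             (cong₂ _xor_ (indicator (proj₁ (ends e))) (indicator (proj₂ (ends e)))))

  even-vertex : ∀ N → n ≡ suc (2 * N) → ∀ S → ∃ λ w → oddAt S w ≡ false
  even-vertex N n≡ S with empty-or-member (λ v → not (oddAt S v))
  ... | inj₂ (w , even) = w , trans (sym (BP.not-involutive _)) (cong not even)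
  ... | inj₁ all-odd = contradiction (trans (sym (all-ones n≡)) (trans (sum-cong-≗ odd) (handshake S))) true≢false
    where
    odd : ∀ v → true ≡ oddAt S v
    odd v = trans (sym (cong not (all-odd v))) (BP.not-involutive _)
    all-ones : ∀ {k} → k ≡ suc (2 * N) → ⨁ {k} (λ _ → true) ≡ true
    all-ones refl = ⨁-odd N

  -- The edge set of a cycle.  Its edges are pairwise distinct, so it is
  -- the sum of their indicators; every vertex has even degree in it.

  module CycleEdges (c : Cycle) where
    open Cycle c

    stepEdge : Fin len → Fin m
    stepEdge i = proj₁ (step i)

    closingEdge : Fin m
    closingEdge = proj₁ close

    edges : Cells m
    edges e = ⨁ (λ i → e == stepEdge i) xor (e == closingEdge)

    stepEdge-injective : ∀ i j → stepEdge i ≡ stepEdge j → i ≡ j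
    stepEdge-injective i j eq
      with joins-ends (subst (λ x → Joins x (vert (inject₁ i)) (vert (suc i))) eq (proj₂ (step i))) (proj₂ (step j))
    ... | inj₁ (same , _) = FP.inject₁-injective (inj same)
    ... | inj₂ (crossed₁ , crossed₂) = contradiction (cong toℕ (inj crossed₂)) (suc-i≢inject₁-j)
      where
      -- i = j + 1 and j = i + 1 cannot both hold
      suc-i≢inject₁-j : toℕ (suc i) ≢ toℕ (inject₁ j)
      suc-i≢inject₁-j eq′ = NP.m≢1+n+m (toℕ j) {1} (sym (trans (cong suc (sym ij)) (trans eq′ (FP.toℕ-inject₁ j))))
        where
        ij : toℕ i ≡ suc (toℕ j)
        ij = trans (sym (FP.toℕ-inject₁ i)) (cong toℕ (inj crossed₁))

    -- The closing edge is not a step edge: otherwise the cycle would have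
    -- only two vertices.
    stepEdge≢closingEdge : ∀ i → stepEdge i ≢ closingEdge
    stepEdge≢closingEdge i eq
      with joins-ends (subst (λ x → Joins x (vert (inject₁ i)) (vert (suc i))) eq (proj₂ (step i))) (proj₂ close)
    ... | inj₁ (same , _) = FP.toℕ-inject₁-≢ i (sym (trans (cong toℕ (inj same)) (FP.toℕ-fromℕ len)))
    ... | inj₂ (crossed₁ , crossed₂) = contradiction (subst (2 ≤_) len≡1 long) λ { (s≤s ()) }
      where
      len≡1 : len ≡ 1
      len≡1 = trans (sym (trans (cong toℕ (inj crossed₂)) (FP.toℕ-fromℕ len)))
                    (cong suc (trans (sym (FP.toℕ-inject₁ i)) (cong toℕ (inj crossed₁))))

    edges→CycleEdge : ∀ e → edges e ≡ true → CycleEdge e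
    edges→CycleEdge e e∈ with e == closingEdge in closing
    ... | true = inj₂ (subst (λ x → Joins x (vert (fromℕ len)) (vert zero)) (sym (==-true closing)) (proj₂ close))
    ... | false =
      let (i , e≡i) = ⨁-true (λ i → e == stepEdge i) (trans (sym (BP.xor-identityʳ _)) e∈)
      in inj₁ (i , subst (λ x → Joins x (vert (inject₁ i)) (vert (suc i))) (sym (==-true e≡i)) (proj₂ (step i)))

    CycleEdge→edges : ∀ e → CycleEdge e → edges e ≡ true
    CycleEdge→edges e (inj₁ (i , j)) =
      let e≡i = joins-unique j (proj₂ (step i))
      in cong₂ _xor_
           (trans (⨁-single _ i (λ i′ i′≢i →
                    ==-≢ (λ e≡i′ → i′≢i (stepEdge-injective i′ i (trans (sym e≡i′) e≡i)))))
                  (==-≡ e≡i))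
           (==-≢ (λ e≡c → stepEdge≢closingEdge i (trans (sym e≡i) e≡c)))
    CycleEdge→edges e (inj₂ j) =
      let e≡c = joins-unique j (proj₂ close)
      in cong₂ _xor_ (⨁-zero _ (λ i → ==-≢ (λ e≡i → stepEdge≢closingEdge i (trans (sym e≡i) e≡c))))
                     (==-≡ e≡c)

    -- Each vertex is counted once by the step edge entering it and once by
    -- the step edge leaving it (cyclically), so every degree is even.
    edges-even : ∀ v → oddAt edges v ≡ false
    edges-even v = begin
      ⨁ (λ e → edges e ∧ incident v e)
        ≡⟨ sum-cong-≗ (λ e → BP.∧-distribʳ-xor (incident v e) (stepIndicators e) (e == closingEdge)) ⟩
      ⨁ (λ e → (stepIndicators e ∧ incident v e) xor ((e == closingEdge) ∧ incident v e))
        ≡⟨ ∑-distrib-+ (λ e → stepIndicators e ∧ incident v e) (λ e → (e == closingEdge) ∧ incident v e) ⟩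
      ⨁ (λ e → stepIndicators e ∧ incident v e) xor ⨁ (λ e → (e == closingEdge) ∧ incident v e)
        ≡⟨ cong₂ _xor_ steps (⨁-point closingEdge (incident v)) ⟩
      ⨁ (λ i → incident v (stepEdge i)) xor incident v closingEdge
        ≡⟨ cong₂ _xor_ (trans (sum-cong-≗ (λ i → incident-joins v (proj₂ (step i))))
                              (∑-distrib-+ (λ i → at (inject₁ i)) (λ i → at (suc i))))
                       (incident-joins v (proj₂ close)) ⟩
      (⨁ (at ∘ inject₁) xor ⨁ (at ∘ suc)) xor (at (fromℕ len) xor at zero)
        ≡⟨ interchange (⨁ (at ∘ inject₁)) (⨁ (at ∘ suc)) (at (fromℕ len)) (at zero) ⟩
      (⨁ (at ∘ inject₁) xor at (fromℕ len)) xor (⨁ (at ∘ suc) xor at zero)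
        ≡⟨ cong₂ _xor_ (sym (sum-init-last at)) (BP.xor-comm (⨁ (at ∘ suc)) (at zero)) ⟩
      ⨁ at xor ⨁ at
        ≡⟨ BP.xor-same (⨁ at) ⟩
      false ∎
      where
      open ≡-Reasoning
      stepIndicators : Cells m
      stepIndicators e = ⨁ (λ i → e == stepEdge i)
      at : Fin (suc len) → Bool
      at k = vert k == v
      steps : ⨁ (λ e → stepIndicators e ∧ incident v e) ≡ ⨁ (λ i → incident v (stepEdge i))
      steps = begin
        ⨁ (λ e → stepIndicators e ∧ incident v e)
          ≡⟨ sum-cong-≗ (λ e → *-distribʳ-sum (incident v e) (λ i → e == stepEdge i)) ⟩
        ⨁ (λ e → ⨁ (λ i → (e == stepEdge i) ∧ incident v e))
          ≡⟨ ∑-comm (λ e i → (e == stepEdge i) ∧ incident v e) ⟩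
        ⨁ (λ i → ⨁ (λ e → (e == stepEdge i) ∧ incident v e))
          ≡⟨ sum-cong-≗ (λ i → ⨁-point (stepEdge i) (incident v)) ⟩
        ⨁ (λ i → incident v (stepEdge i))                  ∎

  cycleSet : Cycle → Cells m
  cycleSet = CycleEdges.edges

  oddAt-△-cycle : ∀ S c v → oddAt (S △ cycleSet c) v ≡ oddAt S v
  oddAt-△-cycle S c v =
    trans (oddAt-△ S (cycleSet c) v) (trans (cong (oddAt S v xor_) (CycleEdges.edges-even c v)) (BP.xor-identityʳ _))

  -- A cycle through the vertices p 0, …, p L (L ≥ 2), given that they are
  -- distinct, consecutive ones are adjacent and p L is adjacent to p 0.
  -- Indexing by ℕ keeps the index arithmetic of later constructions simple.

  module CycleThrough (L : ℕ) (L≥2 : 2 ≤ L) (p : ℕ → Fin n)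
                      (distinct : ∀ a b → a ≤ L → b ≤ L → p a ≡ p b → a ≡ b)
                      (adjacent : ∀ k → k < L → Adj (p k) (p (suc k)))
                      (closing : Adj (p L) (p 0)) where

    cycle : Cycle
    cycle = record
      { len = L
      ; long = L≥2
      ; vert = λ k → p (toℕ k)
      ; inj = λ {x} {y} eq → FP.toℕ-injective (distinct _ _ (FP.toℕ≤pred[n] x) (FP.toℕ≤pred[n] y) eq)
      ; step = λ i → subst (λ z → Adj (p z) (p (suc (toℕ i)))) (sym (FP.toℕ-inject₁ i)) (adjacent (toℕ i) (FP.toℕ<n i))
      ; close = subst (λ z → Adj (p z) (p 0)) (sym (FP.toℕ-fromℕ L)) closing
      }

    edge⁻ : ∀ e → cycleSet cycle e ≡ true →
            (∃ λ k → k < L × Joins e (p k) (p (suc k))) ⊎ Joins e (p L) (p 0)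
    edge⁻ e e∈ with CycleEdges.edges→CycleEdge cycle e e∈
    ... | inj₁ (i , j) = inj₁ (toℕ i , FP.toℕ<n i , subst (λ z → Joins e (p z) (p (suc (toℕ i)))) (FP.toℕ-inject₁ i) j)
    ... | inj₂ j = inj₂ (subst (λ z → Joins e (p z) (p 0)) (FP.toℕ-fromℕ L) j)

    stepEdge∈ : ∀ e k → k < L → Joins e (p k) (p (suc k)) → cycleSet cycle e ≡ true
    stepEdge∈ e k k<L j = CycleEdges.CycleEdge→edges cycle e (inj₁ (fromℕ< k<L ,
      subst₂ (λ z z′ → Joins e (p z) (p z′))
        (sym (trans (FP.toℕ-inject₁ (fromℕ< k<L)) (FP.toℕ-fromℕ< k<L)))
        (sym (cong suc (FP.toℕ-fromℕ< k<L))) j))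

    closingEdge∈ : ∀ e → Joins e (p L) (p 0) → cycleSet cycle e ≡ true
    closingEdge∈ e j = CycleEdges.CycleEdge→edges cycle e (inj₂ (subst (λ z → Joins e (p z) (p 0)) (sym (FP.toℕ-fromℕ L)) j))

  -- Walk along edges of X, never leaving
  -- a vertex by the edge just used to enter it (possible by evenness).  By
  -- pigeonhole some vertex repeats; a repetition with no repetition inside
  -- is a cycle, of length at least 3 because the walk never backtracks.

  module CycleInEvenSet (X : Cells m) (even : ∀ v → oddAt X v ≡ false) (e₀ : Fin m) (X∋e₀ : X e₀ ≡ true) where

    record Position : Set where
      constructor at
      field
        here    : Fin n
        via     : Fin m
        via∈X   : X via ≡ true
        {prev}  : Fin n
        arrived : Joins via here prev
    open Position

    next : (p : Position) → Σ Position λ p′ → Joins (via p′) (here p) (here p′) × via p′ ≢ via p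
    next (at v e e∈X arrived) =
      let (e′ , y , e′≢e , e′∈X , leaves) = leave-again (even v) e∈X arrived
      in at y e′ e′∈X (joins-sym leaves) , leaves , e′≢e

    walk : ℕ → Position
    walk zero = at (proj₁ (ends e₀)) e₀ X∋e₀ (inj₁ refl)
    walk (suc k) = proj₁ (next (walk k))

    vertexAt : ℕ → Fin n
    vertexAt = here ∘ walk

    edgeAt : ℕ → Fin m
    edgeAt = via ∘ walk

    walk-joins : ∀ k → Joins (edgeAt (suc k)) (vertexAt k) (vertexAt (suc k))
    walk-joins k = proj₁ (proj₂ (next (walk k)))

    no-backtrack : ∀ k → edgeAt (suc (suc k)) ≢ edgeAt (suc k)
    no-backtrack k = proj₂ (proj₂ (next (walk (suc k))))

    CycleInX : Set
    CycleInX = Σ Cycle λ c → cycleSet c ⊆ᶜ X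

    closedSegment : ∀ a d → (∀ a′ b′ → a′ < d → b′ < d → vertexAt (a + a′) ≡ vertexAt (a + b′) → a′ ≡ b′) →
                    vertexAt a ≡ vertexAt (a + d) → 1 ≤ d → CycleInX
    closedSegment a 1 _ closed _ =
      contradiction (trans closed (cong vertexAt (NP.+-comm a 1))) (joins-≢ (walk-joins a))
    closedSegment a 2 _ closed _ =
      contradiction (joins-unique (joins-sym back) (walk-joins a)) (no-backtrack a)
      where
      back : Joins (edgeAt (suc (suc a))) (vertexAt (suc a)) (vertexAt a)
      back = subst (Joins (edgeAt (suc (suc a))) (vertexAt (suc a)))
                   (trans (cong vertexAt (NP.+-comm 2 a)) (sym closed)) (walk-joins (suc a))
    closedSegment a (suc (suc (suc d))) distinct closed _ = C.cycle , inX
      where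
      L = suc (suc d)
      p : ℕ → Fin n
      p k = vertexAt (a + k)
      edgeFrom : ℕ → Fin m
      edgeFrom k = edgeAt (suc (a + k))
      steps : ∀ k → Joins (edgeFrom k) (p k) (p (suc k))
      steps k = subst (λ z → Joins (edgeFrom k) (p k) (vertexAt z)) (sym (NP.+-suc a k)) (walk-joins (a + k))
      closes : Joins (edgeFrom L) (p L) (p 0)
      closes = subst (Joins (edgeFrom L) (p L))
        (trans (cong vertexAt (sym (NP.+-suc a L))) (trans (sym closed) (cong vertexAt (sym (NP.+-identityʳ a)))))
        (walk-joins (a + L))
      module C = CycleThrough L (s≤s (s≤s z≤n)) p (λ a′ b′ a′≤ b′≤ → distinct a′ b′ (s≤s a′≤) (s≤s b′≤))
                              (λ k _ → edgeFrom k , steps k) (edgeFrom L , closes)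
      inX : cycleSet C.cycle ⊆ᶜ X
      inX x x∈ with C.edge⁻ x x∈
      ... | inj₁ (k , _ , j) = subst (λ z → X z ≡ true) (joins-unique (steps k) j) (via∈X (walk (suc (a + k))))
      ... | inj₂ j = subst (λ z → X z ≡ true) (joins-unique closes j) (via∈X (walk (suc (a + L))))

    inner-repetition? : ∀ a d → Dec (∃ λ (x : Fin d) → ∃ λ (y : Fin d) →
                          toℕ x < toℕ y × vertexAt (a + toℕ x) ≡ vertexAt (a + toℕ y))
    inner-repetition? a d =
      FP.any? (λ x → FP.any? (λ y → (toℕ x NP.<? toℕ y) ×-dec (vertexAt (a + toℕ x) FP.≟ vertexAt (a + toℕ y))))

    -- Shrink a repetition vertexAt a = vertexAt (a + d) to an innermost one;
    -- F bounds d and decreases along the recursion.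
    innermost : ∀ F a d → d < F → vertexAt a ≡ vertexAt (a + d) → 1 ≤ d → CycleInX
    innermost (suc F) a d (s≤s d≤F) closed d≥1 with inner-repetition? a d
    ... | yes (x , y , x<y , same) =
      let (o , y≡x+1+o) = <⇒∃-+suc x<y
          shorter : suc o < F
          shorter = NP.<-≤-trans (NP.≤-<-trans (NP.m≤n+m (suc o) (toℕ x)) (subst (_< d) y≡x+1+o (FP.toℕ<n y))) d≤F
          y≡ : a + toℕ y ≡ (a + toℕ x) + suc o
          y≡ = trans (cong (a +_) y≡x+1+o) (sym (NP.+-assoc a (toℕ x) (suc o)))
      in innermost F (a + toℕ x) (suc o) shorter (trans same (cong vertexAt y≡)) (s≤s z≤n)
    ... | no none = closedSegment a d distinct closed d≥1
      where
      no-repeat : ∀ {a′ b′} → a′ < d → b′ < d → a′ < b′ → vertexAt (a + a′) ≢ vertexAt (a + b′)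
      no-repeat {a′} {b′} a′<d b′<d a′<b′ same = none (fromℕ< a′<d , fromℕ< b′<d ,
        subst₂ _<_ (sym (FP.toℕ-fromℕ< a′<d)) (sym (FP.toℕ-fromℕ< b′<d)) a′<b′ ,
        subst₂ (λ u w → vertexAt (a + u) ≡ vertexAt (a + w)) (sym (FP.toℕ-fromℕ< a′<d)) (sym (FP.toℕ-fromℕ< b′<d)) same)
      distinct : ∀ a′ b′ → a′ < d → b′ < d → vertexAt (a + a′) ≡ vertexAt (a + b′) → a′ ≡ b′
      distinct a′ b′ a′<d b′<d same with NP.<-cmp a′ b′
      ... | tri< a′<b′ _ _ = contradiction same (no-repeat a′<d b′<d a′<b′)
      ... | tri≈ _ a′≡b′ _ = a′≡b′
      ... | tri> _ _ b′<a′ = contradiction (sym same) (no-repeat b′<d a′<d b′<a′)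

    cycle-in-X : CycleInX
    cycle-in-X with FP.pigeonhole (NP.n<1+n n) (λ (i : Fin (suc n)) → vertexAt (toℕ i))
    ... | (i , j , i<j , same) =
      let (o , j≡i+1+o) = <⇒∃-+suc i<j
      in innermost (suc (suc o)) (toℕ i) (suc o) NP.≤-refl (trans same (cong vertexAt j≡i+1+o)) (s≤s z≤n)

  -- Cycles formed by a path along a fixed cycle H and one or two further
  -- edges.  Vertices of H are indexed by ℕ (saturating at the last one).

  module AlongCycle (H : Cycle) where
    open Cycle H using (len; vert) renaming (inj to vert-injective)
    open CycleEdges H using () renaming (edges to Hedges)

    h : ℕ → Fin n
    h k = vert (clamp k len)

    h-index : ∀ (i : Fin (suc len)) → h (toℕ i) ≡ vert i
    h-index i = cong vert (FP.toℕ-injective (toℕ-clamp (FP.toℕ≤pred[n] i)))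

    h-injective : ∀ a b → a ≤ len → b ≤ len → h a ≡ h b → a ≡ b
    h-injective a b a≤ b≤ same = trans (sym (toℕ-clamp a≤)) (trans (cong toℕ (vert-injective same)) (toℕ-clamp b≤))

    h-step : ∀ k → k < len → Σ (Fin m) λ e → Joins e (h k) (h (suc k)) × Hedges e ≡ true
    h-step k k<len = e , j′ , CycleEdges.CycleEdge→edges H e (inj₁ (i , j))
      where
      i = fromℕ< k<len
      e = proj₁ (Cycle.step H i)
      j = proj₂ (Cycle.step H i)
      j′ : Joins e (h k) (h (suc k))
      j′ = subst₂ (Joins e)
        (trans (sym (h-index (inject₁ i))) (cong h (trans (FP.toℕ-inject₁ i) (FP.toℕ-fromℕ< k<len))))
        (trans (sym (h-index (suc i))) (cong (h ∘ suc) (FP.toℕ-fromℕ< k<len))) j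

    OnH : Fin n → Set
    OnH = Cycle.OnCycle H

    onH? : ∀ x → Dec (OnH x)
    onH? x = FP.any? (λ i → vert i FP.≟ x)

    index : ∀ {x} → OnH x → ∃ λ k → k ≤ len × h k ≡ x
    index (i , vi≡x) = toℕ i , FP.toℕ≤pred[n] i , trans (h-index i) vi≡x

    h-on : ∀ k → OnH (h k)
    h-on k = clamp k len , refl

    module Path (i L : ℕ) (bound : i + L ≤ len) where

      path-distinct : ∀ a b → a ≤ L → b ≤ L → h (i + a) ≡ h (i + b) → a ≡ b
      path-distinct a b a≤L b≤L same = NP.+-cancelˡ-≡ i a b (h-injective _ _ (within a≤L) (within b≤L) same)
        where
        within : ∀ {a} → a ≤ L → i + a ≤ len
        within a≤L = NP.≤-trans (NP.+-monoʳ-≤ i a≤L) bound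

      path-step : ∀ k → k < L → Σ (Fin m) λ e → Joins e (h (i + k)) (h (i + suc k)) × Hedges e ≡ true
      path-step k k<L = subst (λ z → Σ (Fin m) λ e → Joins e (h (i + k)) (h z) × Hedges e ≡ true)
        (sym (NP.+-suc i k)) (h-step (i + k) (NP.<-≤-trans (NP.+-monoʳ-< i k<L) bound))

      path-adjacent : ∀ k → k < L → Adj (h (i + k)) (h (i + suc k))
      path-adjacent k k<L = let (e , j , _) = path-step k k<L in e , j

      path-edge∈H : ∀ k → k < L → ∀ x → Joins x (h (i + k)) (h (i + suc k)) → Hedges x ≡ true
      path-edge∈H k k<L x j = let (e , j′ , e∈H) = path-step k k<L in subst (λ z → Hedges z ≡ true) (joins-unique j′ j) e∈H

    chordCycle : ∀ i d e → i + suc (suc d) ≤ len → Joins e (h i) (h (i + suc (suc d))) →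
                 Σ Cycle λ D → cycleSet D e ≡ true × (∀ x → cycleSet D x ≡ true → Hedges x ≡ false → x ≡ e)
    chordCycle i d e bound j = D.cycle , D.closingEdge∈ e closing , offH
      where
      open Path i (suc (suc d)) bound
      closing : Joins e (h (i + suc (suc d))) (h (i + 0))
      closing = subst (Joins e (h (i + suc (suc d))) ∘ h) (sym (NP.+-identityʳ i)) (joins-sym j)
      module D = CycleThrough (suc (suc d)) (s≤s (s≤s z≤n)) (h ∘ (i +_)) path-distinct path-adjacent (e , closing)
      offH : ∀ x → cycleSet D.cycle x ≡ true → Hedges x ≡ false → x ≡ e
      offH x x∈D x∉H with D.edge⁻ x x∈D
      ... | inj₁ (k , k<L , jx) = contradiction (trans (sym (path-edge∈H k k<L x jx)) x∉H) true≢false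
      ... | inj₂ jx = joins-unique jx closing

    detourCycle : ∀ {w} → ¬ OnH w → ∀ i d ex ey → i + suc d ≤ len → Joins ex w (h i) → Joins ey w (h (i + suc d)) →
                  Σ Cycle λ D → cycleSet D ex ≡ true × cycleSet D ey ≡ true ×
                    (∀ x → cycleSet D x ≡ true → Hedges x ≡ false → (x ≡ ex) ⊎ (x ≡ ey))
    detourCycle {w} w∉H i d ex ey bound jx jy =
      D.cycle , D.stepEdge∈ ex 0 (s≤s z≤n) enter , D.closingEdge∈ ey (joins-sym jy) , offH
      where
      open Path i (suc d) bound
      p : ℕ → Fin n
      p zero = w
      p (suc k) = h (i + k)
      enter : Joins ex (p 0) (p 1)
      enter = subst (Joins ex w ∘ h) (sym (NP.+-identityʳ i)) jx
      distinct : ∀ a b → a ≤ suc (suc d) → b ≤ suc (suc d) → p a ≡ p b → a ≡ b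
      distinct zero zero _ _ _ = refl
      distinct zero (suc b) _ _ w≡ = contradiction (subst OnH (sym w≡) (h-on (i + b))) w∉H
      distinct (suc a) zero _ _ ≡w = contradiction (subst OnH ≡w (h-on (i + a))) w∉H
      distinct (suc a) (suc b) (s≤s a≤) (s≤s b≤) same = cong suc (path-distinct a b a≤ b≤ same)
      adjacent : ∀ k → k < suc (suc d) → Adj (p k) (p (suc k))
      adjacent zero _ = ex , enter
      adjacent (suc k) (s≤s k<) = path-adjacent k k<
      module D = CycleThrough (suc (suc d)) (s≤s (s≤s z≤n)) p distinct adjacent (ey , joins-sym jy)
      offH : ∀ x → cycleSet D.cycle x ≡ true → Hedges x ≡ false → (x ≡ ex) ⊎ (x ≡ ey)
      offH x x∈D x∉H with D.edge⁻ x x∈D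
      ... | inj₁ (zero , _ , jx′) = inj₁ (joins-unique jx′ enter)
      ... | inj₁ (suc k , s≤s k<L , jx′) = contradiction (trans (sym (path-edge∈H k k<L x jx′)) x∉H) true≢false
      ... | inj₂ jx′ = inj₂ (joins-unique jx′ (joins-sym jy))

    -- An
    -- edge e ∈ S outside H lies on a "detour" for S: a cycle D through e
    -- whose edges outside H all lie in S.  (If e is a chord of H, D is the
    -- chord cycle; if e ends at w ∉ H, evenness at w provides a second edge
    -- of S at w and D is the detour cycle through w.)  Replacing S by S △ D
    -- keeps all degree parities and removes e and no other edge outside H
    -- is added; iterating, S is carried into H.

    module Reduction (w : Fin n) (cover : ∀ x → x ≢ w → OnH x) where

      Detour : Cells m → Fin m → Set
      Detour S e = Σ Cycle λ D → cycleSet D e ≡ true × (∀ x → cycleSet D x ≡ true → Hedges x ≡ false → S x ≡ true)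

      chordDetour : ∀ {S : Cells m} {e i j} → S e ≡ true → Hedges e ≡ false → i < j → j ≤ len → Joins e (h i) (h j) → Detour S e
      chordDetour {S} {e} {i} S∋e e∉H i<j j≤len je with <⇒∃-+suc i<j
      ... | zero , refl = contradiction (trans (sym e∈H) e∉H) true≢false
        where
        e∈H : Hedges e ≡ true
        e∈H = Path.path-edge∈H i 1 j≤len 0 (s≤s z≤n) e (subst (λ z → Joins e (h z) (h (i + 1))) (sym (NP.+-identityʳ i)) je)
      ... | suc d , refl =
        let (D , e∈D , onlyE) = chordCycle i d e j≤len je
        in D , e∈D , λ x x∈D x∉H → subst (λ z → S z ≡ true) (sym (onlyE x x∈D x∉H)) S∋e

      wDetour : ∀ {S : Cells m} {ex ey k k′} → ¬ OnH w → k < k′ → k′ ≤ len → Joins ex w (h k) → Joins ey w (h k′) →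
                S ex ≡ true → S ey ≡ true →
                Σ Cycle λ D → cycleSet D ex ≡ true × cycleSet D ey ≡ true ×
                  (∀ x → cycleSet D x ≡ true → Hedges x ≡ false → S x ≡ true)
      wDetour {S} {ex} {ey} {k} w∉H k<k′ k′≤len jx jy S∋ex S∋ey with <⇒∃-+suc k<k′
      ... | d , refl =
        let (D , ex∈D , ey∈D , onlyExEy) = detourCycle w∉H k d ex ey k′≤len jx jy
        in D , ex∈D , ey∈D , λ x x∈D x∉H → one-of (onlyExEy x x∈D x∉H)
        where
        one-of : ∀ {x} → (x ≡ ex) ⊎ (x ≡ ey) → S x ≡ true
        one-of (inj₁ refl) = S∋ex
        one-of (inj₂ refl) = S∋ey

      viaW : ∀ {S : Cells m} {e b} → S e ≡ true → ¬ OnH w → oddAt S w ≡ false → Joins e w b → Detour S e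
      viaW {S} {e} {b} S∋e w∉H even je =
        let (e′ , b′ , e′≢e , S∋e′ , je′) = leave-again even S∋e je
            (k , k≤ , hk≡b) = index (cover b (joins-≢ je ∘ sym))
            (k′ , k′≤ , hk′≡b′) = index (cover b′ (joins-≢ je′ ∘ sym))
        in compare e′≢e S∋e′ (subst (Joins e w) (sym hk≡b) je) (subst (Joins e′ w) (sym hk′≡b′) je′) k≤ k′≤
        where
        compare : ∀ {e′ k k′} → e′ ≢ e → S e′ ≡ true → Joins e w (h k) → Joins e′ w (h k′) → k ≤ len → k′ ≤ len → Detour S e
        compare {e′} {k} {k′} e′≢e S∋e′ je je′ k≤ k′≤ with NP.<-cmp k k′
        ... | tri< k<k′ _ _ = let (D , e∈D , _ , off) = wDetour w∉H k<k′ k′≤ je je′ S∋e S∋e′ in D , e∈D , off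
        ... | tri≈ _ refl _ = contradiction (joins-unique je′ je) e′≢e
        ... | tri> _ _ k′<k = let (D , _ , e∈D , off) = wDetour w∉H k′<k k≤ je′ je S∋e′ S∋e in D , e∈D , off

      offH : Cells m → Cells m
      offH S e = S e ∧ not (Hedges e)

      off-H-vertex : ∀ {x} → ¬ OnH x → x ≡ w
      off-H-vertex {x} x∉H with x FP.≟ w
      ... | yes x≡w = x≡w
      ... | no x≢w = contradiction (cover x x≢w) x∉H

      detour : ∀ {S e} → offH S e ≡ true → OnH w ⊎ oddAt S w ≡ false → Detour S e
      detour {S} {e} e∈S∖H w-ok = by-endpoints (onH? a) (onH? b)
        where
        a = proj₁ (ends e)
        b = proj₂ (ends e)
        je : Joins e a b
        je = inj₁ refl
        S∋e = proj₁ (∧≡true e∈S∖H)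
        e∉H = not≡true (proj₂ (∧≡true {S e} e∈S∖H))
        even-at-w : ¬ OnH w → oddAt S w ≡ false
        even-at-w w∉H = evenness w-ok
          where
          evenness : OnH w ⊎ oddAt S w ≡ false → oddAt S w ≡ false
          evenness (inj₁ w∈H) = contradiction w∈H w∉H
          evenness (inj₂ even) = even
        at-w : ∀ {x y} → ¬ OnH x → Joins e x y → Detour S e
        at-w {x} x∉H jxy with off-H-vertex x∉H
        ... | refl = viaW S∋e x∉H (even-at-w x∉H) jxy
        by-endpoints : Dec (OnH a) → Dec (OnH b) → Detour S e
        by-endpoints (no a∉H) _ = at-w a∉H je
        by-endpoints (yes _) (no b∉H) = at-w b∉H (joins-sym je)
        by-endpoints (yes a∈H) (yes b∈H) with index a∈H | index b∈H
        ... | ka , ka≤ , hka≡a | kb , kb≤ , hkb≡b with NP.<-cmp ka kb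
        ...   | tri< ka<kb _ _ = chordDetour S∋e e∉H ka<kb kb≤ (subst₂ (Joins e) (sym hka≡a) (sym hkb≡b) je)
        ...   | tri≈ _ refl _ = contradiction (trans (sym hka≡a) hkb≡b) (joins-≢ je)
        ...   | tri> _ _ kb<ka = chordDetour S∋e e∉H kb<ka ka≤ (subst₂ (Joins e) (sym hkb≡b) (sym hka≡a) (joins-sym je))

      detour-shrinks : ∀ {S e} → offH S e ≡ true → ((D , _) : Detour S e) →
                       size (offH (S △ cycleSet D)) < size (offH S)
      detour-shrinks {S} {e} e∈S∖H (D , e∈D , D∖H⊆S) =
        size-mono-< (λ x → pointwise (S x) (cycleSet D x) (Hedges x) (D∖H⊆S x)) e e∈S∖H
          (cong₂ (λ s d → (s xor d) ∧ not (Hedges e)) S∋e e∈D)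
        where
        S∋e = proj₁ (∧≡true {S e} e∈S∖H)
        pointwise : ∀ s d hd → (d ≡ true → hd ≡ false → s ≡ true) → (s xor d) ∧ not hd ≡ true → s ∧ not hd ≡ true
        pointwise true _ false _ _ = refl
        pointwise false true false D∖H⊆S _ = D∖H⊆S refl refl
        pointwise false false false _ ()
        pointwise s d true _ r = contradiction (trans (sym r) (BP.∧-zeroʳ (s xor d))) true≢false

      module Carry (P : Cells m → Set) (P-step : ∀ S c → P S → P (S △ cycleSet c)) where

        record Carried (S : Cells m) : Set where
          field
            T         : Cells m
            transport : P S → P T
            parity    : ∀ v → oddAt T v ≡ oddAt S v
            inside    : T ⊆ᶜ Hedges

        carry-below : ∀ N S → size (offH S) < N → OnH w ⊎ oddAt S w ≡ false → Carried S
        carry-below (suc N) S (s≤s bound) w-ok with empty-or-member (offH S)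
        ... | inj₁ S∖H≡∅ = record { T = S ; transport = λ PS → PS ; parity = λ _ → refl ; inside = inH }
          where
          inH : S ⊆ᶜ Hedges
          inH e S∋e with Hedges e in He
          ... | true = refl
          ... | false = contradiction (trans (sym (cong₂ (λ s h → s ∧ not h) S∋e He)) (S∖H≡∅ e)) true≢false
        ... | inj₂ (e , e∈S∖H) = record
          { T = Carried.T rest
          ; transport = Carried.transport rest ∘ P-step S D
          ; parity = λ v → trans (Carried.parity rest v) (oddAt-△-cycle S D v)
          ; inside = Carried.inside rest
          }
          where
          d = detour e∈S∖H w-ok
          D = proj₁ d
          rest : Carried (S △ cycleSet D)
          rest = carry-below N (S △ cycleSet D) (NP.<-≤-trans (detour-shrinks e∈S∖H d) bound)
                   (map₂ (trans (oddAt-△-cycle S D w)) w-ok)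

        carry : ∀ S → OnH w ⊎ oddAt S w ≡ false → Carried S
        carry S = carry-below (suc (size (offH S))) S NP.≤-refl

-- Transporting a matroid on Fin k to the cells Fin m along a bijection.

vec-ext : ∀ {A : Set} {k} {xs ys : Vec A k} → (∀ i → lookup xs i ≡ lookup ys i) → xs ≡ ys
vec-ext {xs = xs} {ys} same = trans (sym (VP.tabulate∘lookup xs)) (trans (VP.tabulate-cong same) (VP.tabulate∘lookup ys))

lookup-─ : ∀ {k} (p q : Subset k) i → lookup (p ─ q) i ≡ lookup p i ∧ not (lookup q i)
lookup-─ (x ∷ p) (true ∷ q) zero = sym (BP.∧-zeroʳ x)
lookup-─ (x ∷ p) (false ∷ q) zero = sym (BP.∧-identityʳ x)
lookup-─ (x ∷ p) (y ∷ q) (suc i) = lookup-─ p q i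

module PullBack {m k : ℕ} (B : Matroid k) (f : Fin m ↔ Fin k) where
  open Matroid B using (IsCircuit)
  open Inverse f using (to; from; strictlyInverseˡ; strictlyInverseʳ)

  push : Cells m → Subset k
  push s = tabulate (s ∘ from)

  pull : Subset k → Cells m
  pull Y i = lookup Y (to i)

  push-pull : ∀ Y → push (pull Y) ≡ Y
  push-pull Y = vec-ext (λ j → trans (VP.lookup∘tabulate _ j) (cong (lookup Y) (strictlyInverseˡ j)))

  lookup-push : ∀ s i → lookup (push s) (to i) ≡ s i
  lookup-push s i = trans (VP.lookup∘tabulate _ (to i)) (cong s (strictlyInverseʳ i))

  image-tabulate : ∀ s → image f (tabulate s) ≡ push s
  image-tabulate s = VP.tabulate-cong (λ j → VP.lookup∘tabulate s (from j))

  Circuit : Cells m → Set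
  Circuit s = IsCircuit (push s)

  open CircuitSums Circuit public

  circuit-nonempty : ∀ {s} → Circuit s → ∃ λ i → s i ≡ true
  circuit-nonempty {s} cs with empty-or-member s
  ... | inj₂ member = member
  ... | inj₁ s≡∅ = contradiction (subst IsCircuit push-s≡⊥ cs) (Matroid.emptyNot B)
    where
    push-s≡⊥ : push s ≡ SS.⊥
    push-s≡⊥ = vec-ext (λ j → trans (VP.lookup∘tabulate _ j) (trans (s≡∅ (from j)) (sym (VP.lookup-replicate j false))))

  circuit-minimal : ∀ {s t} → Circuit s → Circuit t → s ⊆ᶜ t → s ≗ t
  circuit-minimal {s} {t} cs ct s⊆t i =
    trans (sym (lookup-push s i)) (trans (cong (λ z → lookup z (to i)) (Matroid.minimal B cs ct push⊆)) (lookup-push t i))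
    where
    push⊆ : push s SS.⊆ push t
    push⊆ {x} x∈ = VP.lookup⇒[]= x (push t)
      (trans (VP.lookup∘tabulate _ x) (s⊆t (from x) (trans (sym (VP.lookup∘tabulate _ x)) (VP.[]=⇒lookup x∈))))

  list-circuitSum : ∀ Cs → All IsCircuit Cs → AllPairs Disjoint Cs → CircuitSum (pull (⋃ Cs))
  list-circuitSum [] [] [] = noCircuit (λ i → VP.lookup-replicate (to i) false)
  list-circuitSum (Y ∷ Cs) (cY ∷ cs) (Y-disjoint ∷ ds) =
    addCircuit (pull Y) (pull (⋃ Cs)) (subst IsCircuit (sym (push-pull Y)) cY) (list-circuitSum Cs cs ds)
      (λ i → misses-union Y Cs Y-disjoint (to i)) (λ i → VP.lookup-zipWith _∨_ (to i) Y (⋃ Cs))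
    where
    misses-union : ∀ (Y : Subset k) Cs → All (Disjoint Y) Cs → ∀ j → lookup Y j ∧ lookup (⋃ Cs) j ≡ false
    misses-union Y [] [] j = trans (cong (lookup Y j ∧_) (VP.lookup-replicate j false)) (BP.∧-zeroʳ _)
    misses-union Y (Z ∷ Cs) (Y∩Z≡∅ ∷ rest) j =
      trans (cong (lookup Y j ∧_) (VP.lookup-zipWith _∨_ j Z (⋃ Cs)))
        (misses-both (lookup Y j) (BP.¬-not (λ both → Y∩Z≡∅ (j , VP.lookup⇒[]= j (Y ∩ Z) (trans (VP.lookup-zipWith _∧_ j Y Z) both))))
                     (misses-union Y Cs rest j))
      where
      misses-both : ∀ y {z u} → y ∧ z ≡ false → y ∧ u ≡ false → y ∧ (z ∨ u) ≡ false
      misses-both false _ _ = refl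
      misses-both true refl u≡ = u≡

  binary-△ : IsBinary B → ∀ {A C} → Circuit A → Circuit C → CircuitSum (A △ C)
  binary-△ binary {A} {C} cA cC with binary cA cC
  ... | Cs , cs , ds , ⋃Cs≡ = CircuitSum-resp pointwise (list-circuitSum Cs cs ds)
    where
    pointwise : ∀ i → pull (⋃ Cs) i ≡ A i xor C i
    pointwise i = begin
      lookup (⋃ Cs) (to i)                                      ≡⟨ cong (λ z → lookup z (to i)) ⋃Cs≡ ⟩
      lookup ((push A ∪ push C) ─ (push A ∩ push C)) (to i)     ≡⟨ lookup-─ (push A ∪ push C) (push A ∩ push C) (to i) ⟩
      lookup (push A ∪ push C) (to i) ∧ not (lookup (push A ∩ push C) (to i))
        ≡⟨ cong₂ (λ a b → a ∧ not b) (VP.lookup-zipWith _∨_ (to i) (push A) (push C)) (VP.lookup-zipWith _∧_ (to i) (push A) (push C)) ⟩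
      (lookup (push A) (to i) ∨ lookup (push C) (to i)) ∧ not (lookup (push A) (to i) ∧ lookup (push C) (to i))
        ≡⟨ cong₂ (λ a c → (a ∨ c) ∧ not (a ∧ c)) (lookup-push A i) (lookup-push C i) ⟩
      (A i ∨ C i) ∧ not (A i ∧ C i)                              ≡⟨ BP.xor-is-ok (A i) (C i) ⟨
      A i xor C i                                                ∎
      where open ≡-Reasoning

module CircuitInjection (G : Graph) {k : ℕ} (B : Matroid k) (binary : IsBinary B)
                        (f : Fin (Graph.m G) ↔ Fin k) (injection : IsCircuitInjection G B f) where
  open GraphFacts G
  open PullBack B f
  open Closure circuit-nonempty (λ {A} {C} → binary-△ binary {A} {C})

  cycleSet-isCircuit : ∀ c → Graph.IsCircuit G (tabulate (cycleSet c))
  cycleSet-isCircuit c = c , λ e → mk⇔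
    (λ e∈ → CycleEdges.edges→CycleEdge c e (trans (sym (VP.lookup∘tabulate _ e)) (VP.[]=⇒lookup e∈)))
    (λ e∈c → VP.lookup⇒[]= e _ (trans (VP.lookup∘tabulate _ e) (CycleEdges.CycleEdge→edges c e e∈c)))

  cycle-circuit : ∀ c → Circuit (cycleSet c)
  cycle-circuit c = subst (Matroid.IsCircuit B) (image-tabulate (cycleSet c)) (injection _ (cycleSet-isCircuit c))

  -- A circuit sum inside the edge set of a cycle H is empty or, by
  -- minimality of circuits, all of H; either way all degrees are even.
  inside-cycle-even : ∀ H {T} → CircuitSum T → T ⊆ᶜ cycleSet H → ∀ v → oddAt T v ≡ false
  inside-cycle-even H (noCircuit T≡∅) _ v = trans (oddAt-cong T≡∅ v) (⨁-zero (λ e → false ∧ incident v e) (λ _ → refl))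
  inside-cycle-even H {T} (addCircuit C s′ cC _ C∩s′ T≡) T⊆H v =
    trans (oddAt-cong T≡H v) (CycleEdges.edges-even H v)
    where
    C⊆T : C ⊆ᶜ T
    C⊆T i Ci = trans (T≡ i) (cong (_∨ s′ i) Ci)
    C≡H : C ≗ cycleSet H
    C≡H = circuit-minimal cC (cycle-circuit H) (λ i Ci → T⊆H i (C⊆T i Ci))
    s′≡∅ : ∀ i → s′ i ≡ false
    s′≡∅ i with s′ i in s′i
    ... | false = refl
    ... | true = contradiction (trans (sym C∩s′-i) (C∩s′ i)) true≢false
      where
      T∋i : T i ≡ true
      T∋i = trans (T≡ i) (trans (cong (C i ∨_) s′i) (BP.∨-zeroʳ (C i)))
      C∩s′-i : C i ∧ s′ i ≡ true
      C∩s′-i = cong₂ _∧_ (trans (C≡H i) (T⊆H i T∋i)) s′i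
    T≡H : T ≗ cycleSet H
    T≡H i = trans (T≡ i) (trans (cong (C i ∨_) (s′≡∅ i)) (trans (BP.∨-identityʳ (C i)) (C≡H i)))

  circuit-is-cycle : ∀ (H : Cycle) w → (∀ x → x ≢ w → Cycle.OnCycle H x) →
                     ∀ {X} → Circuit X → Cycle.OnCycle H w ⊎ oddAt X w ≡ false →
                     Σ Cycle λ c → cycleSet c ≗ X
  circuit-is-cycle H w cover {X} cX w-ok = c , circuit-minimal (cycle-circuit c) cX c⊆X
    where
    open AlongCycle.Reduction.Carry H w cover CircuitSum (λ S c sum → △-closed sum (singleton (cycle-circuit c)))
    carried = carry X w-ok
    even : ∀ v → oddAt X v ≡ false
    even v = trans (sym (Carried.parity carried v))
               (inside-cycle-even H (Carried.transport carried (singleton cX)) (Carried.inside carried) v)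
    e₀ = circuit-nonempty {X} cX
    open CycleInEvenSet X even (proj₁ e₀) (proj₂ e₀) using (cycle-in-X)
    c = proj₁ cycle-in-X
    c⊆X = proj₂ cycle-in-X

  circuit-is-image : ∀ {C′} → Matroid.IsCircuit B C′ →
                     ∀ (H : Cycle) w → (∀ x → x ≢ w → Cycle.OnCycle H x) →
                     Cycle.OnCycle H w ⊎ oddAt (pull C′) w ≡ false →
                     ∃ λ S → Graph.IsCircuit G S × image f S ≡ C′
  circuit-is-image {C′} cC′ H w cover w-ok =
    let (c , c≡X) = circuit-is-cycle H w cover (subst (Matroid.IsCircuit B) (sym (push-pull C′)) cC′) w-ok
    in tabulate (cycleSet c) , cycleSet-isCircuit c ,
       trans (image-tabulate (cycleSet c)) (trans (VP.tabulate-cong (c≡X ∘ Inverse.from f)) (push-pull C′))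

-- Lemma 2.3.  For odd order, choose a vertex w of even degree in the
-- pulled-back circuit and a cycle through all other vertices; for even
-- order, use a Hamiltonian cycle.

lemma2p3 : (G : Graph) → Graph.NoIsolatedVertices G →
    (∀ (N : ℕ) → Graph.n G ≡ suc (2 * N) → Graph.AlmostHamiltonian G →
      ¬ ExistsNontrivialBinaryCI G)
    × (∀ (N : ℕ) → Graph.n G ≡ 2 * N → Graph.Hamiltonian G →
      ¬ ExistsNontrivialBinaryCI G)
lemma2p3 G _ = odd-order , even-order
  where
  open GraphFacts G using (even-vertex)

  odd-order : ∀ N → Graph.n G ≡ suc (2 * N) → Graph.AlmostHamiltonian G → ¬ ExistsNontrivialBinaryCI G
  odd-order N n≡2N+1 almost (_ , B , binary , f , injection , C′ , cC′ , not-image) =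
    let (w , even) = even-vertex N n≡2N+1 (PullBack.pull B f C′)
        (H , cover) = almost w
    in not-image (CircuitInjection.circuit-is-image G B binary f injection cC′ H w cover (inj₂ even))

  even-order : ∀ N → Graph.n G ≡ 2 * N → Graph.Hamiltonian G → ¬ ExistsNontrivialBinaryCI G
  even-order _ _ (H , through-all) (_ , B , binary , f , injection , C′ , cC′ , not-image) =
    not-image (CircuitInjection.circuit-is-image G B binary f injection cC′
                 H (Graph.Cycle.vert H zero) (λ x _ → through-all x) (inj₁ (through-all _)))
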